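{- Let $m\ge1$ and $1\le i\le m$ be integers, let \[ G_{m,i}(z,q)=\Bigl(\prod_{b=1}^{i-1}\frac{1}{1-q^b}\Bigr)\prod_{a=1}^\infty\prod_{d=0}^{m-1}\frac{1}{1-z^aq^{i+(a-1)m+d}}, \] and $F_N(z)=[q^N]G_{m,i}(z,q)$ (so $F_N=0$ for $N<0$). If $m>i+1$ and $j>n/(i+1)$, then $[z^j]F_n(z)=[z^{j-1}]F_{n-i}(z)$. Equivalently, $\Lambda_{m,i}(n,j)=\Lambda_{m,i}(n-i,j-1)$ under these conditions.
   Context: $G_{m,i}$ equals the generating function $\sum_{n,k}\Lambda_{m,i}(n,k)z^kq^n$, where $\Lambda_{m,i}(n,k)$ is the number of partitions $\lambda=(\lambda_1\ge\lambda_2\ge\cdots)$ of $n$ such that $\sum_{j\equiv i \pmod m}\lambda_j=k$. -}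

module Defs where

open import Data.Nat using (ℕ; zero; suc; _+_; _*_; _∸_; _/_; _%_; _≟_; NonZero)
open import Data.Integer using (ℤ; +_; -[1+_])
open import Data.List using (List; []; _∷_; _++_; replicate; map; concatMap; upTo; filter; length)
open import Relation.Nullary.Decidable using (does)
open import Data.Bool using (if_then_else_)

-- parts n p : the list of all partitions of n whose parts are all ≤ p,
-- each partition written as a non-increasing list of positive parts
-- (λ₁ ≥ λ₂ ≥ ⋯ > 0).
parts : ℕ → ℕ → List (List ℕ)
parts zero    zero    = [] ∷ []
parts (suc _) zero    = []
parts n       (suc p) =
  concatMap (λ c → map (replicate c (suc p) ++_) (parts (n ∸ c * suc p) p))
            (upTo (suc (n / suc p)))

partitions : ℕ → List (List ℕ)
partitions n = parts n n

wsumFrom : (m : ℕ) → .{{NonZero m}} → ℕ → ℕ → List ℕ → ℕ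
wsumFrom m i j []      = 0
wsumFrom m i j (x ∷ l) =
  (if does (j % m ≟ i % m) then x else 0) + wsumFrom m i (suc j) l

-- Σ_{j ≡ i (mod m)} λ_j, positions 1-indexed
wsum : (m : ℕ) → .{{NonZero m}} → ℕ → List ℕ → ℕ
wsum m i λs = wsumFrom m i 1 λs

Λ : (m : ℕ) → .{{NonZero m}} → ℕ → ℕ → ℕ → ℕ
Λ m i n k = length (filter (λ λs → wsum m i λs ≟ k) (partitions n))

Λℤ : (m : ℕ) → .{{NonZero m}} → ℕ → ℤ → ℕ → ℕ
Λℤ m i (+ n)      k = Λ m i n k
Λℤ m i -[1+ _ ]   k = 0

-- Write i = k + 1 and let λ be a partition of n whose parts at positions ≡ i (mod m) add up to
-- j > n/(i+1).  Then λ_i > λ_{i+1}: otherwise the i + 1 parts λ_1, …, λ_{i+1} are all ≥ λ_i,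
-- and each later counted part λ_{i+tm} is dominated by the m - 1 ≥ i + 1 parts just before it,
-- so n ≥ (i+1) j.  Hence subtracting 1 from each of λ_1, …, λ_i is a bijection onto the
-- partitions of n - i with weight j - 1, inverse to adding 1 to the first i parts.
module Submission where

open import Defs
open import Data.Nat using (ℕ; _+_; _*_; _∸_; _≤_; _<_; NonZero)
open import Data.Integer using (+_; _-_)
open import Relation.Binary.PropositionalEquality using (_≡_)
open import Data.Nat.Properties

open import Algebra.Properties.CommutativeSemigroup +-commutativeSemigroup using (x∙yz≈y∙xz)
open import Data.Empty using (⊥; ⊥-elim)
import Data.Integer.Properties as ℤ
open import Data.List using (List; []; _∷_; _++_; replicate; map; concatMap; upTo; filter; length)
open import Data.List.Membership.Propositional using (_∈_; _─_; find; lose)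
open import Data.List.Membership.Propositional.Properties
  using (∈-map⁺; ∈-map⁻; ∈-concatMap⁺; ∈-concatMap⁻; ∈-upTo⁺; ∈-upTo⁻; ∈-filter⁺; ∈-filter⁻)
open import Data.List.Properties using (++-cancelˡ; ∷-injectiveʳ; length-removeAt′)
open import Data.List.Relation.Unary.All using (All; []; _∷_)
import Data.List.Relation.Unary.All as All
import Data.List.Relation.Unary.All.Properties as All
open import Data.List.Relation.Unary.AllPairs using ([]; _∷_)
open import Data.List.Relation.Unary.Any using (here; there; index)
open import Data.List.Relation.Unary.Unique.Propositional using (Unique)
import Data.List.Relation.Unary.Unique.Propositional.Properties as Unique
open import Data.Nat using (zero; suc; pred; >-nonZero; z≤n; s≤s; z<s; _≟_; _≤?_; _<?_; _/_; _%_)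
open import Data.Nat.DivMod using (m≡m%n+[m/n]*n; [m+n]%n≡m%n; m*n/n≡m; m/n*n≤m; /-monoˡ-≤)
open import Data.Nat.Divisibility using (_∣_; divides; ∣m+n∣m⇒∣n; n∣m*n; ∣⇒≤)
open import Data.Nat.ListAction using (sum)
open import Data.Nat.ListAction.Properties using (sum-++)
open import Data.Product using (_×_; _,_; ∃-syntax)
open import Function using (_∘_)
open import Relation.Binary.PropositionalEquality
  using (_≢_; refl; sym; trans; cong; subst; subst₂; module ≡-Reasoning)
open import Relation.Nullary using (yes; no; contradiction)
open import Relation.Nullary.Decidable using (dec-true; dec-false)

∈-─⁺ : ∀ {A : Set} {y z : A} {ys} (y∈ys : y ∈ ys) → z ∈ ys → z ≢ y → z ∈ ys ─ y∈ys
∈-─⁺ (here refl)   (here refl)  z≢y = contradiction refl z≢y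
∈-─⁺ (here _)      (there z∈ys) _   = z∈ys
∈-─⁺ (there _)     (here z≡y)   _   = here z≡y
∈-─⁺ (there y∈ys) (there z∈ys) z≢y = there (∈-─⁺ y∈ys z∈ys z≢y)

injection⇒length≤ : ∀ {A B : Set} (f : A → B) {xs : List A} {ys : List B} → Unique xs →
                    (∀ {x} → x ∈ xs → f x ∈ ys) →
                    (∀ {x y} → x ∈ xs → y ∈ xs → f x ≡ f y → x ≡ y) →
                    length xs ≤ length ys
injection⇒length≤ f {[]}     _                 _    _   = z≤n
injection⇒length≤ f {x ∷ xs} {ys} (x≢xs ∷ uniq) maps inj =
  subst (suc (length xs) ≤_) (sym (length-removeAt′ ys (index fx∈ys)))
    (s≤s (injection⇒length≤ f uniq maps′ (λ x′∈ y′∈ → inj (there x′∈) (there y′∈))))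
  where
  fx∈ys = maps (here refl)
  maps′ : ∀ {x′} → x′ ∈ xs → f x′ ∈ ys ─ fx∈ys
  maps′ x′∈xs = ∈-─⁺ fx∈ys (maps (there x′∈xs))
    (λ fx′≡fx → All.lookup x≢xs x′∈xs (sym (inj (there x′∈xs) (here refl) fx′≡fx)))

Unique-concatMap⁺ : ∀ {A B : Set} (f : A → List B) {xs} → Unique xs → (∀ x → Unique (f x)) →
                    (∀ {x x′ v} → v ∈ f x → v ∈ f x′ → x ≡ x′) → Unique (concatMap f xs)
Unique-concatMap⁺ f {[]}     _             _     _        = []
Unique-concatMap⁺ f {x ∷ xs} (x≢xs ∷ uniq) uniqf disjoint =
  Unique.++⁺ (uniqf x) (Unique-concatMap⁺ f uniq uniqf disjoint) apart
  where
  apart : ∀ {v} → v ∈ f x × v ∈ concatMap f xs → ⊥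
  apart (v∈fx , v∈rest) with find (∈-concatMap⁻ f v∈rest)
  ... | x′ , x′∈xs , v∈fx′ = All.lookup x≢xs x′∈xs (disjoint v∈fx v∈fx′)

empty⇒length≡0 : ∀ {A : Set} {xs : List A} → (∀ {x} → x ∈ xs → ⊥) → length xs ≡ 0
empty⇒length≡0 {xs = []}    _     = refl
empty⇒length≡0 {xs = _ ∷ _} empty = ⊥-elim (empty (here refl))

-- Partitions as lists.

data NonIncr : ℕ → List ℕ → Set where
  []  : ∀ {a} → NonIncr a []
  _∷_ : ∀ {a x l} → x ≤ a → NonIncr x l → NonIncr a (x ∷ l)

NonIncr-weaken : ∀ {a b l} → a ≤ b → NonIncr a l → NonIncr b l
NonIncr-weaken a≤b []         = []
NonIncr-weaken a≤b (x≤a ∷ ni) = ≤-trans x≤a a≤b ∷ ni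

NonIncr-sum : ∀ {a l} → NonIncr a l → NonIncr (sum l) l
NonIncr-sum []       = []
NonIncr-sum (_ ∷ ni) = m≤m+n _ _ ∷ ni

record IsPartition (p n : ℕ) (l : List ℕ) : Set where
  field
    nonIncr  : NonIncr p l
    positive : All (0 <_) l
    sum≡     : sum l ≡ n
open IsPartition

sum-replicate : ∀ c x → sum (replicate c x) ≡ c * x
sum-replicate zero    x = refl
sum-replicate (suc c) x = cong (_+_ x) (sum-replicate c x)

sum-copies : ∀ c x r → sum (replicate c x ++ r) ≡ c * x + sum r
sum-copies c x r = trans (sum-++ (replicate c x) r) (cong (_+ sum r) (sum-replicate c x))

NonIncr-copies : ∀ c {a q r} → q ≤ a → NonIncr q r → NonIncr a (replicate c q ++ r)
NonIncr-copies zero    q≤a ni = NonIncr-weaken q≤a ni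
NonIncr-copies (suc c) q≤a ni = q≤a ∷ NonIncr-copies c ≤-refl ni

split-copies : ∀ p {l} → NonIncr (suc p) l → ∃[ c ] ∃[ r ] (l ≡ replicate c (suc p) ++ r × NonIncr p r)
split-copies p []                   = 0 , [] , refl , []
split-copies p {x ∷ l} (x≤1+p ∷ ni) with x ≟ suc p
... | yes refl with split-copies p ni
...   | c , r , refl , ni′ = suc c , r , refl , ni′
split-copies p {x ∷ l} (x≤1+p ∷ ni) | no x≢1+p =
  0 , x ∷ l , refl , ≤-pred (≤∧≢⇒< x≤1+p x≢1+p) ∷ ni

copies-injective : ∀ p c c′ {r r′} → NonIncr p r → NonIncr p r′ →
                   replicate c (suc p) ++ r ≡ replicate c′ (suc p) ++ r′ → c ≡ c′
copies-injective p zero    zero     _ _ _ = refl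
copies-injective p (suc c) (suc c′) ni ni′ eq =
  cong suc (copies-injective p c c′ ni ni′ (∷-injectiveʳ eq))
copies-injective p zero    (suc c′) (x≤p ∷ _) _ refl = contradiction x≤p (<⇒≱ (n<1+n p))
copies-injective p (suc c) zero     _ (x≤p ∷ _) refl = contradiction x≤p (<⇒≱ (n<1+n p))

IsPartition-copies : ∀ {p n c r} → c * suc p ≤ n → IsPartition p (n ∸ c * suc p) r →
                     IsPartition (suc p) n (replicate c (suc p) ++ r)
IsPartition-copies {p} {n} {c} {r} bound π = record
  { nonIncr  = NonIncr-copies c ≤-refl (NonIncr-weaken (n≤1+n p) (nonIncr π))
  ; positive = All.++⁺ (All.replicate⁺ c z<s) (positive π)
  ; sum≡     = trans (sum-copies c (suc p) r)
                     (trans (cong (_+_ (c * suc p)) (sum≡ π)) (m+[n∸m]≡n bound))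
  }

IsPartition-uncopies : ∀ {p n c r} → NonIncr p r → IsPartition (suc p) n (replicate c (suc p) ++ r) →
                       c * suc p ≤ n × IsPartition p (n ∸ c * suc p) r
IsPartition-uncopies {p} {n} {c} {r} ni π =
  subst (c * suc p ≤_) total (m≤m+n _ _) ,
  record
    { nonIncr  = ni
    ; positive = All.++⁻ʳ (replicate c (suc p)) (positive π)
    ; sum≡     = trans (sym (m+n∸m≡n (c * suc p) (sum r))) (cong (_∸ c * suc p) total)
    }
  where
  total : c * suc p + sum r ≡ n
  total = trans (sym (sum-copies c (suc p) r)) (sum≡ π)

partsWith : ℕ → ℕ → ℕ → List (List ℕ)
partsWith n p c = map (replicate c (suc p) ++_) (parts (n ∸ c * suc p) p)

parts-suc : ∀ n p → parts n (suc p) ≡ concatMap (partsWith n p) (upTo (suc (n / suc p)))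
parts-suc zero    p = refl
parts-suc (suc n) p = refl

∈-upTo-quotient⁻ : ∀ {c n q} → c ∈ upTo (suc (n / suc q)) → c * suc q ≤ n
∈-upTo-quotient⁻ {n = n} {q} c∈ = ≤-trans (*-monoˡ-≤ (suc q) (≤-pred (∈-upTo⁻ c∈))) (m/n*n≤m n (suc q))

∈-upTo-quotient⁺ : ∀ {c n q} → c * suc q ≤ n → c ∈ upTo (suc (n / suc q))
∈-upTo-quotient⁺ {c} {n} {q} bound =
  ∈-upTo⁺ (s≤s (subst (_≤ n / suc q) (m*n/n≡m c (suc q)) (/-monoˡ-≤ (suc q) bound)))

∈-parts⁻ : ∀ n p {l} → l ∈ parts n p → IsPartition p n l
∈-parts⁻ zero    zero    (here refl) = record { nonIncr = [] ; positive = [] ; sum≡ = refl }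
∈-parts⁻ n       (suc p) l∈ rewrite parts-suc n p with find (∈-concatMap⁻ (partsWith n p) l∈)
... | c , c∈ , l∈c with ∈-map⁻ (replicate c (suc p) ++_) l∈c
... | r , r∈ , refl = IsPartition-copies (∈-upTo-quotient⁻ c∈) (∈-parts⁻ (n ∸ c * suc p) p r∈)

∈-parts⁺ : ∀ n p {l} → IsPartition p n l → l ∈ parts n p
∈-parts⁺ n zero {[]} record { sum≡ = refl } = here refl
∈-parts⁺ n zero {x ∷ l} record { nonIncr = x≤0 ∷ _ ; positive = 0<x ∷ _ } =
  contradiction x≤0 (<⇒≱ 0<x)
∈-parts⁺ n (suc p) π with split-copies p (nonIncr π)
... | c , r , refl , ni with IsPartition-uncopies ni π
... | bound , π′ rewrite parts-suc n p =
  ∈-concatMap⁺ (partsWith n p)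
    (lose (∈-upTo-quotient⁺ bound) (∈-map⁺ (replicate c (suc p) ++_) (∈-parts⁺ (n ∸ c * suc p) p π′)))

parts-unique : ∀ n p → Unique (parts n p)
parts-unique zero    zero    = [] ∷ []
parts-unique (suc n) zero    = []
parts-unique n       (suc p) rewrite parts-suc n p =
  Unique-concatMap⁺ (partsWith n p) (Unique.upTo⁺ (suc (n / suc p)))
    (λ c → Unique.map⁺ (++-cancelˡ (replicate c (suc p)) _ _) (parts-unique (n ∸ c * suc p) p))
    disjoint
  where
  disjoint : ∀ {c c′ v} → v ∈ partsWith n p c → v ∈ partsWith n p c′ → c ≡ c′
  disjoint {c} {c′} v∈ v∈′
    with ∈-map⁻ (replicate c (suc p) ++_) v∈ | ∈-map⁻ (replicate c′ (suc p) ++_) v∈′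
  ... | r , r∈ , refl | r′ , r′∈ , eq =
    copies-injective p c c′ (nonIncr (∈-parts⁻ (n ∸ c * suc p) p r∈))
                            (nonIncr (∈-parts⁻ (n ∸ c′ * suc p) p r′∈)) eq

∈-partitions⁺ : ∀ {a n l} → NonIncr a l → All (0 <_) l → sum l ≡ n → l ∈ partitions n
∈-partitions⁺ {n = n} ni pos refl =
  ∈-parts⁺ n n record { nonIncr = NonIncr-sum ni ; positive = pos ; sum≡ = refl }

-- Weights.

-- weight m k l = l_k + l_{k+m} + l_{k+2m} + ⋯, positions counted from 0.
weight : ℕ → ℕ → List ℕ → ℕ
weight m k       []      = 0
weight m zero    (x ∷ l) = x + weight m (pred m) l
weight m (suc k) (x ∷ l) = weight m k l

[m+n]%d≡m%d⇒d∣n : ∀ m n d .{{_ : NonZero d}} → (m + n) % d ≡ m % d → d ∣ n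
[m+n]%d≡m%d⇒d∣n m n d same = ∣m+n∣m⇒∣n (divides ((m + n) / d) shifted) (n∣m*n (m / d))
  where
  open ≡-Reasoning
  shifted : m / d * d + n ≡ (m + n) / d * d
  shifted = +-cancelˡ-≡ (m % d) _ _ (begin
    m % d + (m / d * d + n)       ≡⟨ sym (+-assoc (m % d) _ n) ⟩
    m % d + m / d * d + n         ≡⟨ cong (_+ n) (sym (m≡m%n+[m/n]*n m d)) ⟩
    m + n                         ≡⟨ m≡m%n+[m/n]*n (m + n) d ⟩
    (m + n) % d + (m + n) / d * d ≡⟨ cong (_+ (m + n) / d * d) same ⟩
    m % d + (m + n) / d * d       ∎)

-- k is the distance from position j to the next position counted by wsumFrom.
wsumFrom≡weight : ∀ m .{{_ : NonZero m}} i j k l → k < m → (j + k) % m ≡ i % m →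
                  wsumFrom m i j l ≡ weight m k l
wsumFrom≡weight m i j k [] _ _ = refl
wsumFrom≡weight m@(suc m′) i j zero (x ∷ l) _ hit
  with hit₀ ← trans (cong (_% m) (sym (+-identityʳ j))) hit
  rewrite dec-true (j % m ≟ i % m) hit₀ =
  cong (_+_ x) (wsumFrom≡weight m i (suc j) m′ l ≤-refl
                 (trans (cong (_% m) (sym (+-suc j m′))) (trans ([m+n]%n≡m%n j m) hit₀)))
wsumFrom≡weight m i j (suc k) (x ∷ l) k<m hit
  rewrite dec-false (j % m ≟ i % m)
            (λ j≡i → <⇒≱ k<m (∣⇒≤ ([m+n]%d≡m%d⇒d∣n j (suc k) m (trans hit (sym j≡i))))) =
  wsumFrom≡weight m i (suc j) k l (<⇒≤ k<m) (trans (cong (_% m) (sym (+-suc j k))) hit)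

partAt : ℕ → List ℕ → ℕ
partAt _       []      = 0
partAt zero    (x ∷ _) = x
partAt (suc k) (_ ∷ l) = partAt k l

Gap : ℕ → List ℕ → Set
Gap k l = partAt (suc k) l < partAt k l

suc*x+s≤t*a+[x+s] : ∀ t {x a} s → x ≤ a → suc t * x + s ≤ t * a + (x + s)
suc*x+s≤t*a+[x+s] t {x} {a} s x≤a = begin
  x + t * x + s   ≤⟨ +-monoˡ-≤ s (+-monoʳ-≤ x (*-monoʳ-≤ t x≤a)) ⟩
  x + t * a + s   ≡⟨ cong (_+ s) (+-comm x (t * a)) ⟩
  t * a + x + s   ≡⟨ +-assoc (t * a) x s ⟩
  t * a + (x + s) ∎
  where open ≤-Reasoning

-- The t virtual parts a in front of l make the induction go through: each counted part x is
-- dominated by the ≤ m parts ending at it.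
weight-bound : ∀ M t a k c {l} → NonIncr a l → c ≤ suc (t + k) → c ≤ suc M →
               c * weight (suc M) k l ≤ t * a + sum l
weight-bound M t a k c {[]} [] _ _ rewrite *-zeroʳ c = z≤n
weight-bound M t a zero c {x ∷ l} (x≤a ∷ ni) c≤ c≤m = begin
  c * (x + weight (suc M) M l)        ≡⟨ *-distribˡ-+ c x _ ⟩
  c * x + c * weight (suc M) M l      ≤⟨ +-mono-≤ (*-monoˡ-≤ x (subst (c ≤_) (cong suc (+-identityʳ t)) c≤))
                                                  (weight-bound M 0 x M c ni c≤m c≤m) ⟩
  suc t * x + sum l                   ≤⟨ suc*x+s≤t*a+[x+s] t (sum l) x≤a ⟩
  t * a + (x + sum l)                 ∎
  where open ≤-Reasoning
weight-bound M t a (suc k) c {x ∷ l} (x≤a ∷ ni) c≤ c≤m = begin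
  c * weight (suc M) k l ≤⟨ weight-bound M (suc t) x k c ni
                               (subst (c ≤_) (cong suc (+-suc t k)) c≤) c≤m ⟩
  suc t * x + sum l      ≤⟨ suc*x+s≤t*a+[x+s] t (sum l) x≤a ⟩
  t * a + (x + sum l)    ∎
  where open ≤-Reasoning

-- Without a gap at k, the part after l_k also dominates it, which buys one more copy of l_k.
flat-weight-bound : ∀ M t a k c {l} → NonIncr a l → partAt k l ≤ partAt (suc k) l →
                    c ≤ suc (suc (t + k)) → c ≤ suc M → c * weight (suc (suc M)) k l ≤ t * a + sum l
flat-weight-bound M t a k c {[]} [] _ _ _ rewrite *-zeroʳ c = z≤n
flat-weight-bound M t a zero c {x ∷ []} (_ ∷ []) x≤0 _ _ rewrite n≤0⇒n≡0 x≤0 | *-zeroʳ c = z≤n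
flat-weight-bound M t a zero c {x ∷ y ∷ l} (x≤a ∷ (_ ∷ ni)) x≤y c≤ c≤m = begin
  c * (x + weight (suc (suc M)) M l)       ≡⟨ *-distribˡ-+ c x _ ⟩
  c * x + c * weight (suc (suc M)) M l     ≤⟨ +-monoʳ-≤ (c * x)
                                                (weight-bound (suc M) 0 y M c ni c≤m (m≤n⇒m≤1+n c≤m)) ⟩
  c * x + sum l                            ≤⟨ +-monoˡ-≤ (sum l)
                                                (*-monoˡ-≤ x (subst (c ≤_) (cong (suc ∘ suc) (+-identityʳ t)) c≤)) ⟩
  x + suc t * x + sum l                    ≡⟨ +-assoc x (suc t * x) (sum l) ⟩
  x + (suc t * x + sum l)                  ≤⟨ +-monoʳ-≤ x (suc*x+s≤t*a+[x+s] t (sum l) x≤a) ⟩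
  x + (t * a + (x + sum l))                ≡⟨ x∙yz≈y∙xz x (t * a) _ ⟩
  t * a + (x + (x + sum l))                ≤⟨ +-monoʳ-≤ (t * a) (+-monoʳ-≤ x (+-monoˡ-≤ (sum l) x≤y)) ⟩
  t * a + (x + (y + sum l))                ∎
  where open ≤-Reasoning
flat-weight-bound M t a (suc k) c {x ∷ l} (x≤a ∷ ni) flat c≤ c≤m = begin
  c * weight (suc (suc M)) k l ≤⟨ flat-weight-bound M (suc t) x k c ni flat
                                     (subst (c ≤_) (cong (suc ∘ suc) (+-suc t k)) c≤) c≤m ⟩
  suc t * x + sum l            ≤⟨ suc*x+s≤t*a+[x+s] t (sum l) x≤a ⟩
  t * a + (x + sum l)          ∎
  where open ≤-Reasoning

heavy⇒gap : ∀ M k c {a l} → NonIncr a l → c ≤ suc (suc k) → c ≤ suc M →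
            sum l < c * weight (suc (suc M)) k l → Gap k l
heavy⇒gap M k c {l = l} ni c≤ c≤m heavy with partAt (suc k) l <? partAt k l
... | yes gap = gap
... | no ¬gap = contradiction (flat-weight-bound M 0 _ k c ni (≮⇒≥ ¬gap) c≤ c≤m) (<⇒≱ heavy)

-- Adding 1 to the first k parts, and its inverse.

-- Missing parts count as 0, so raise may lengthen μ.
raise : ℕ → List ℕ → List ℕ
raise zero    μ       = μ
raise (suc k) []      = 1 ∷ raise k []
raise (suc k) (x ∷ μ) = suc x ∷ raise k μ

infixr 5 _∷⁺_
_∷⁺_ : ℕ → List ℕ → List ℕ
zero  ∷⁺ l = l
suc x ∷⁺ l = suc x ∷ l

lower : ℕ → List ℕ → List ℕ
lower zero    l       = l
lower (suc k) []      = []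
lower (suc k) (x ∷ l) = pred x ∷⁺ lower k l

sum-raise : ∀ k μ → sum (raise k μ) ≡ k + sum μ
sum-raise zero    μ       = refl
sum-raise (suc k) []      = cong suc (sum-raise k [])
sum-raise (suc k) (x ∷ μ) = cong suc (trans (cong (_+_ x) (sum-raise k μ)) (x∙yz≈y∙xz x k (sum μ)))

weight-raise : ∀ m k μ → weight m k (raise (suc k) μ) ≡ suc (weight m k μ)
weight-raise m zero    []      = refl
weight-raise m zero    (x ∷ μ) = refl
weight-raise m (suc k) []      = weight-raise m k []
weight-raise m (suc k) (x ∷ μ) = weight-raise m k μ

NonIncr-raise : ∀ k {a μ} → NonIncr a μ → NonIncr (suc a) (raise k μ)
NonIncr-raise zero    ni         = NonIncr-weaken (n≤1+n _) ni
NonIncr-raise (suc k) []         = s≤s z≤n ∷ NonIncr-raise k []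
NonIncr-raise (suc k) (x≤a ∷ ni) = s≤s x≤a ∷ NonIncr-raise k ni

positive-raise : ∀ k {μ} → All (0 <_) μ → All (0 <_) (raise k μ)
positive-raise zero    pos       = pos
positive-raise (suc k) []        = z<s ∷ positive-raise k []
positive-raise (suc k) (_ ∷ pos) = z<s ∷ positive-raise k pos

lower-raise : ∀ k {μ} → All (0 <_) μ → lower k (raise k μ) ≡ μ
lower-raise zero    pos = refl
lower-raise (suc k) {[]}        []        = lower-raise k []
lower-raise (suc k) {suc x ∷ μ} (_ ∷ pos) = cong (suc x ∷_) (lower-raise k pos)

positive-∷⁺ : ∀ y {r} → All (0 <_) r → All (0 <_) (y ∷⁺ r)
positive-∷⁺ zero    pos = pos
positive-∷⁺ (suc y) pos = z<s ∷ pos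

positive-lower : ∀ k {l} → All (0 <_) l → All (0 <_) (lower k l)
positive-lower zero    pos       = pos
positive-lower (suc k) []        = []
positive-lower (suc k) (_ ∷ pos) = positive-∷⁺ _ (positive-lower k pos)

NonIncr-∷⁺ : ∀ {y a r} → y ≤ a → NonIncr y r → NonIncr a (y ∷⁺ r)
NonIncr-∷⁺ {zero}  _   ni = NonIncr-weaken z≤n ni
NonIncr-∷⁺ {suc y} y≤a ni = y≤a ∷ ni

NonIncr-head : ∀ {a b l} → NonIncr a l → partAt 0 l ≤ b → NonIncr b l
NonIncr-head []       _   = []
NonIncr-head (_ ∷ ni) x≤b = x≤b ∷ ni

NonIncr-lower : ∀ k {a l} → NonIncr a l → Gap k l → NonIncr (pred a) (lower (suc k) l)
NonIncr-lower k       []         _   = []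
NonIncr-lower zero    (x≤a ∷ ni) gap =
  NonIncr-∷⁺ (pred-mono-≤ x≤a) (NonIncr-head ni (suc[m]≤n⇒m≤pred[n] gap))
NonIncr-lower (suc k) (x≤a ∷ ni) gap = NonIncr-∷⁺ (pred-mono-≤ x≤a) (NonIncr-lower k ni gap)

NonIncr-0 : ∀ {l} → NonIncr 0 l → All (0 <_) l → l ≡ []
NonIncr-0 []        _         = refl
NonIncr-0 (x≤0 ∷ _) (0<x ∷ _) = contradiction x≤0 (<⇒≱ 0<x)

-- The gap guarantees that a part lowered to 0 is followed only by parts lowered to 0.
raise-lower : ∀ k {a l} → NonIncr a l → All (0 <_) l → Gap k l → raise (suc k) (lower (suc k) l) ≡ l
raise-lower zero    {l = suc (suc x) ∷ l}     _ _ _ = refl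
raise-lower zero    {l = suc zero ∷ []}       _ _ _ = refl
raise-lower zero    {l = suc zero ∷ y ∷ l}    _ (_ ∷ 0<y ∷ _) gap = contradiction (≤-pred gap) (<⇒≱ 0<y)
raise-lower (suc k) {l = suc (suc x) ∷ l} (_ ∷ ni) (_ ∷ pos) gap =
  cong (suc (suc x) ∷_) (raise-lower k ni pos gap)
raise-lower (suc k) {l = suc zero ∷ l}    (_ ∷ ni) (_ ∷ pos) gap = begin
  raise (suc (suc k)) (lower (suc k) l) ≡⟨ cong (raise (suc (suc k))) lowered ⟩
  1 ∷ raise (suc k) []                  ≡⟨ cong (λ r → 1 ∷ raise (suc k) r) (sym lowered) ⟩
  1 ∷ raise (suc k) (lower (suc k) l)   ≡⟨ cong (1 ∷_) (raise-lower k ni pos gap) ⟩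
  1 ∷ l                                 ∎
  where
  open ≡-Reasoning
  lowered : lower (suc k) l ≡ []
  lowered = NonIncr-0 (NonIncr-lower k ni gap) (positive-lower (suc k) pos)

-- The shift, for m = M + 2 and i = k + 1.

module _ (M k : ℕ) (i+1<m : suc k + 1 < suc (suc M)) where

  private
    m = suc (suc M)
    i = suc k

  Λ-list : ℕ → ℕ → List (List ℕ)
  Λ-list n j = filter (λ l → wsum m i l ≟ j) (partitions n)

  wsum≡weight : ∀ l → wsum m i l ≡ weight m k l
  wsum≡weight l = wsumFrom≡weight m i 1 k l (m+n≤o⇒m≤o i (<⇒≤ i+1<m)) refl

  ∈-Λ-list⁻ : ∀ n j {l} → l ∈ Λ-list n j → IsPartition n n l × weight m k l ≡ j
  ∈-Λ-list⁻ n j {l} l∈ with l∈ns , w≡j ← ∈-filter⁻ (λ l → wsum m i l ≟ j) l∈ =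
    ∈-parts⁻ n n l∈ns , trans (sym (wsum≡weight l)) w≡j

  ∈-Λ-list⁺ : ∀ {a n j l} → NonIncr a l → All (0 <_) l → sum l ≡ n → weight m k l ≡ j →
              l ∈ Λ-list n j
  ∈-Λ-list⁺ {j = j} {l} ni pos sum≡n w≡j =
    ∈-filter⁺ (λ l → wsum m i l ≟ j) (∈-partitions⁺ ni pos sum≡n) (trans (wsum≡weight l) w≡j)

  Λ-list-unique : ∀ n j → Unique (Λ-list n j)
  Λ-list-unique n j = Unique.filter⁺ (λ l → wsum m i l ≟ j) (parts-unique n n)

  module _ {n j : ℕ} (heavy : n < j * (i + 1)) where

    heavy-gap : ∀ {l} → l ∈ Λ-list n j → Gap k l
    heavy-gap {l} l∈ with π , w≡j ← ∈-Λ-list⁻ n j l∈ =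
      heavy⇒gap M k (i + 1) (nonIncr π) (≤-reflexive (+-comm i 1)) (≤-pred i+1<m)
        (subst₂ _<_ (sym (sum≡ π)) (trans (*-comm j (i + 1)) (cong ((i + 1) *_) (sym w≡j))) heavy)

    raise-lower-Λ : ∀ {l} → l ∈ Λ-list n j → raise i (lower i l) ≡ l
    raise-lower-Λ l∈ with π , _ ← ∈-Λ-list⁻ n j l∈ = raise-lower k (nonIncr π) (positive π) (heavy-gap l∈)

    sum-lower-Λ : ∀ {l} → l ∈ Λ-list n j → i + sum (lower i l) ≡ n
    sum-lower-Λ {l} l∈ with π , _ ← ∈-Λ-list⁻ n j l∈ =
      trans (sym (sum-raise i (lower i l))) (trans (cong sum (raise-lower-Λ l∈)) (sum≡ π))

    lower-∈ : ∀ {l} → l ∈ Λ-list n j → lower i l ∈ Λ-list (n ∸ i) (j ∸ 1)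
    lower-∈ {l} l∈ with π , w≡j ← ∈-Λ-list⁻ n j l∈ =
      ∈-Λ-list⁺ (NonIncr-lower k (nonIncr π) (heavy-gap l∈)) (positive-lower i (positive π))
        (trans (sym (m+n∸m≡n i _)) (cong (_∸ i) (sum-lower-Λ l∈)))
        (cong pred (trans (sym (weight-raise m k (lower i l)))
                          (trans (cong (weight m k) (raise-lower-Λ l∈)) w≡j)))

    raise-∈ : i ≤ n → ∀ {μ} → μ ∈ Λ-list (n ∸ i) (j ∸ 1) → raise i μ ∈ Λ-list n j
    raise-∈ i≤n {μ} μ∈ with π , w≡j-1 ← ∈-Λ-list⁻ (n ∸ i) (j ∸ 1) μ∈ =
      ∈-Λ-list⁺ (NonIncr-raise i (nonIncr π)) (positive-raise i (positive π))
        (trans (sum-raise i μ) (trans (cong (_+_ i) (sum≡ π)) (m+[n∸m]≡n i≤n)))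
        (trans (weight-raise m k μ) (trans (cong suc w≡j-1) (suc-pred j {{j≢0}})))
      where
      j≢0 : NonZero j
      j≢0 = m*n≢0⇒m≢0 j {{>-nonZero (≤-trans (s≤s z≤n) heavy)}}

    Λ-shift : i ≤ n → Λ m i n j ≡ Λ m i (n ∸ i) (j ∸ 1)
    Λ-shift i≤n = ≤-antisym
      (injection⇒length≤ (lower i) (Λ-list-unique n j) lower-∈
        λ x∈ y∈ eq → trans (sym (raise-lower-Λ x∈)) (trans (cong (raise i) eq) (raise-lower-Λ y∈)))
      (injection⇒length≤ (raise i) (Λ-list-unique (n ∸ i) (j ∸ 1)) (raise-∈ i≤n)
        λ x∈ y∈ eq → trans (sym (lower-raise i (positive-of x∈)))
                           (trans (cong (lower i) eq) (lower-raise i (positive-of y∈))))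
      where
      positive-of : ∀ {μ} → μ ∈ Λ-list (n ∸ i) (j ∸ 1) → All (0 <_) μ
      positive-of μ∈ with π , _ ← ∈-Λ-list⁻ (n ∸ i) (j ∸ 1) μ∈ = positive π

    Λ-vanish : n < i → Λ m i n j ≡ 0
    Λ-vanish n<i = empty⇒length≡0 λ l∈ → <⇒≱ n<i (subst (i ≤_) (sum-lower-Λ l∈) (m≤m+n i _))

Λℤ-+-≥ : ∀ m .{{_ : NonZero m}} i n k → i ≤ n → Λℤ m i (+ n - + i) k ≡ Λ m i (n ∸ i) k
Λℤ-+-≥ m i n k i≤n rewrite ℤ.m-n≡m⊖n n i | ℤ.⊖-≥ i≤n = refl

Λℤ-+-< : ∀ m .{{_ : NonZero m}} i n k → n < i → Λℤ m i (+ n - + i) k ≡ 0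
Λℤ-+-< m i n k n<i rewrite ℤ.m-n≡m⊖n n i | ℤ.⊖-< n<i with i ∸ n | m>n⇒m∸n≢0 n<i
... | zero  | i∸n≢0 = contradiction refl i∸n≢0
... | suc _ | _     = refl

theorem8 : (m i : ℕ) → .{{_ : NonZero m}} → 1 ≤ i → i ≤ m → i + 1 < m →
           (n j : ℕ) → n < j * (i + 1) →
           Λ m i n j ≡ Λℤ m i (+ n - + i) (j ∸ 1)
theorem8 (suc zero)    (suc k) _ _ (s≤s ()) _ _ _
theorem8 (suc (suc M)) (suc k) _ _ i+1<m    n j heavy with suc k ≤? n
... | yes i≤n = trans (Λ-shift M k i+1<m heavy i≤n) (sym (Λℤ-+-≥ _ _ n _ i≤n))
... | no  i≰n = trans (Λ-vanish M k i+1<m heavy (≰⇒> i≰n)) (sym (Λℤ-+-< _ _ n _ (≰⇒> i≰n)))
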